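{- Let $k,\ell\ge0$, let $T$ be a set of $t\ge1$ positive integers, and let $\mathfrak{T}_T$ be the set of words $\pi=\pi_0\pi_1\cdots\pi_t$ with $\pi_0=0$ and $\pi_1\cdots\pi_t$ a permutation of $T$. Then the number of contained $(k,\ell)$-pullback $(t,t)$-parking functions is \[ |\mathrm{C}_{t,t}(k,\ell)|=\sum_{\pi\in\mathfrak{T}_T}\left(\prod_{i=1}^{t}\bigl[\mathrm{B}(\pi_i)+\mathrm{F}(\pi_i)+1\bigr]\right),\qquad \mathrm{B}(\pi_i)=\min(\mathrm{Right}(\pi_i),k),\quad \mathrm{F}(\pi_i)=\max(\min(\mathrm{Left}(\pi_i)-k,\ell),0), \] and the summand for $\pi$ is the number of contained $(k,\ell)$-pullback $(t,t)$-parking functions (for the cars of $T$) with outcome $\pi$.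
   Context: $(k,\ell)$-pullback parking rule: cars enter in order; a car with preference $a$ parks in spot $a$ if it is empty; otherwise it checks spots $a-1,\dots,a-k$ in order (not below the first spot of the street) and parks in the first empty one; if none, it checks spots $a+1,\dots,a+\ell$ in order (not beyond the last spot) and parks in the first empty one; otherwise it fails. $\mathrm{C}_{t,t}(k,\ell)$ is the set of preference lists in $[t]^t$ for $t$ cars such that, when an extra empty spot $0$ is placed before spot $1$ and the cars park by this rule on spots $0,1,\dots,t$, all cars park in spots $1,\dots,t$ and no car backs into spot $0$ (for cars labeled by $T$, entering in increasing label order). The outcome is $\pi_0\pi_1\cdots\pi_t$ with $\pi_0=0$ and $\pi_u$ the car parked in spot $u$. $\mathrm{Right}(\pi_i)$ is the largest $x\ge0$ with $\pi_y<\pi_i$ for all $i+1\le y\le i+x\le t$; $\mathrm{Left}(\pi_i)$ is the largest $x\ge0$ with $0<\pi_z<\pi_i$ for all $1\le i-x\le z\le i-1$. -}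

module Defs where

open import Data.Nat using (ℕ; zero; suc; _+_; _*_; _∸_; _⊓_; _<_; _<ᵇ_; _≤ᵇ_)
open import Data.Bool using (Bool; true; false; if_then_else_; _∧_)
open import Data.Maybe using (Maybe; just; nothing; fromMaybe; is-nothing)
open import Data.List using (List; []; _∷_; map; concatMap; upTo; length; takeWhileᵇ; drop; take; reverse; replicate)
open import Data.Nat.ListAction using (product)
open import Data.Product using (_×_; _,_)

-- Street occupancy: a list of length t+1, entry u = car in spot u (if any)

Street : Set
Street = List (Maybe ℕ)

free : Street → ℕ → Bool
free []       _       = false
free (s ∷ _)  zero    = is-nothing s
free (_ ∷ ss) (suc u) = free ss u

place : Street → ℕ → ℕ → Street
place []       _       _ = []
place (_ ∷ ss) zero    c = just c ∷ ss
place (s ∷ ss) (suc u) c = s ∷ place ss u c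

-- backward search: from preference p, check p-1, p-2, ..., p-k (never below spot 0)
backSearch : Street → (p k : ℕ) → Maybe ℕ
backSearch st p       zero    = nothing
backSearch st zero    (suc k) = nothing
backSearch st (suc p) (suc k) = if free st p then just p else backSearch st p k

-- forward search: from preference p, check p+1, ..., p+ℓ (never beyond the last spot)
fwdSearch : Street → (p ℓ : ℕ) → Maybe ℕ
fwdSearch st p zero    = nothing
fwdSearch st p (suc ℓ) = if free st (suc p) then just (suc p) else fwdSearch st (suc p) ℓ

chooseSpot : (k ℓ : ℕ) → Street → ℕ → Maybe ℕ
chooseSpot k ℓ st a with free st a
... | true  = just a
... | false with backSearch st a k
...   | just s  = just s
...   | nothing = fwdSearch st a ℓ

-- cars (labels, in entering order) with preferences; nothing = some car fails
parkAll : (k ℓ : ℕ) → Street → List ℕ → List ℕ → Maybe Street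
parkAll k ℓ st (c ∷ cs) (a ∷ as) with chooseSpot k ℓ st a
... | just s  = parkAll k ℓ (place st s c) cs as
... | nothing = nothing
parkAll k ℓ st _ _ = just st

-- Parking on spots 0,1,...,t (spot 0 is the extra spot), cars = T in
-- increasing order (T is given as a strictly increasing list).
parkOn0t : (k ℓ t : ℕ) → (T : List ℕ) → (α : List ℕ) → Maybe Street
parkOn0t k ℓ t T α = parkAll k ℓ (replicate (suc t) nothing) T α

-- outcome π₀π₁⋯π_t (π₀ = 0) if α is a contained (k,ℓ)-pullback (t,t)-parking
-- function: all cars park and no car uses spot 0 (then spots 1..t are full)
containedOutcome : (k ℓ t : ℕ) → (T : List ℕ) → (α : List ℕ) → Maybe (List ℕ)
containedOutcome k ℓ t T α with parkOn0t k ℓ t T α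
... | just (nothing ∷ rest) = just (0 ∷ map (fromMaybe 0) rest)
... | _                     = nothing

isContained : (k ℓ t : ℕ) → (T : List ℕ) → (α : List ℕ) → Bool
isContained k ℓ t T α with containedOutcome k ℓ t T α
... | just _  = true
... | nothing = false

words : (t n : ℕ) → List (List ℕ)
words t zero    = [] ∷ []
words t (suc n) = concatMap (λ a → map (a ∷_) (words t n)) (map suc (upTo t))

insertions : ℕ → List ℕ → List (List ℕ)
insertions x []       = (x ∷ []) ∷ []
insertions x (y ∷ ys) = (x ∷ y ∷ ys) ∷ map (y ∷_) (insertions x ys)

perms : List ℕ → List (List ℕ)
perms []       = [] ∷ []
perms (x ∷ xs) = concatMap (insertions x) (perms xs)

wordsT : List ℕ → List (List ℕ)
wordsT T = map (0 ∷_) (perms T)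

at : List ℕ → ℕ → ℕ
at π i = fromMaybe 0 (lookupM π i)
  where
  lookupM : List ℕ → ℕ → Maybe ℕ
  lookupM []       _       = nothing
  lookupM (x ∷ _)  zero    = just x
  lookupM (_ ∷ xs) (suc n) = lookupM xs n

-- largest x ≥ 0 with π_y < π_i for all i+1 ≤ y ≤ i+x ≤ t
Right : List ℕ → ℕ → ℕ
Right π i = length (takeWhileᵇ (λ v → v <ᵇ at π i) (drop (suc i) π))

-- largest x ≥ 0 with 0 < π_z < π_i for all 1 ≤ i-x ≤ z ≤ i-1
Left : List ℕ → ℕ → ℕ
Left π i = length (takeWhileᵇ (λ v → (0 <ᵇ v) ∧ (v <ᵇ at π i)) (reverse (take i π)))

B : (k : ℕ) → List ℕ → ℕ → ℕ
B k π i = Right π i ⊓ k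

-- max(min(Left - k, ℓ), 0) computed with truncated subtraction (equal values)
F : (k ℓ : ℕ) → List ℕ → ℕ → ℕ
F k ℓ π i = (Left π i ∸ k) ⊓ ℓ

weight : (k ℓ t : ℕ) → List ℕ → ℕ
weight k ℓ t π = product (map (λ i → B k π i + F k ℓ π i + 1) (map suc (upTo t)))

{-# OPTIONS --safe #-}
module Submission where

-- Cars enter in increasing order, so if α has outcome 0π₁⋯π_t then car π_i
-- arrives when exactly the spots holding smaller cars are occupied: the street it
-- sees depends on the outcome only. On that street the runs i+1, …, i+Right(π_i)
-- and i-Left(π_i), …, i-1 are occupied and bounded by free spots (spot 0 is always
-- free). A preference i+1+e reaches i by backing up iff e < min(Right, k); a
-- preference i-1-d must first find all of its k backward spots inside the left
-- run and then reach i moving forward, i.e. d+k < Left and d < ℓ. So exactly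
-- B+F+1 preferences put car π_i in spot i, independently of the other cars, and
-- the number of α with outcome π is the product of these factors. Every contained
-- α has exactly one outcome, a permutation of T that occurs once in 𝔗_T; summing
-- the fibres gives the total count.

open import Defs
open import Data.Nat using (ℕ; _<_; _≤_)
open import Data.List using (List; length; filter; map)
open import Data.Nat.ListAction using (sum)
open import Data.List.Relation.Unary.All using (All)
open import Data.List.Relation.Unary.Linked using (Linked)
open import Data.List.Membership.Propositional using (_∈_)
open import Data.Maybe using (just)
import Data.Maybe.Properties as MP
import Data.List.Properties as LP
open import Data.Nat.Properties using (_≟_)
open import Data.Product using (_×_)
open import Relation.Binary.PropositionalEquality using (_≡_)
open import Relation.Nullary.Decidable using (T?)

import Data.Bool as Bool
open import Data.Bool using (true; false; if_then_else_; not; _∧_)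
open import Data.Bool.Properties using (T-≡)
open import Data.List using ([]; _∷_; [_]; _++_; _∷ʳ_; concatMap; applyUpTo; upTo; takeWhileᵇ; drop; take; reverse;
  catMaybes; replicate)
open import Data.List.Membership.Propositional using (_∉_; find)
open import Data.List.Membership.Propositional.Properties using (∈-concatMap⁻; ∈-map⁻; ∈-∃++; ∈-++⁺ˡ)
open import Data.List.Properties using (filter-≐; filter-++; filter-none; filter-all; filter-accept; length-++;
  length-applyUpTo; length-take; length-drop; length-reverse; length-catMaybes; length-replicate; map-cong;
  map-cong-local; map-∘; map-applyUpTo; concatMap-pure; unfold-reverse; ++-identityʳ; ∷-injectiveˡ; ∷-injectiveʳ)
open import Data.List.Relation.Binary.Permutation.Propositional using (_↭_; ↭-refl; ↭-prep; ↭-swap; ↭-trans; ↭-sym; ↭⇒↭ₛ)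
open import Data.List.Relation.Binary.Permutation.Propositional.Properties using (↭-length; ↭-empty-inv; drop-∷; shift;
  ++⁺ˡ; map⁺; ∈-resp-↭; All-resp-↭)
import Data.List.Relation.Unary.All as All
open import Data.List.Relation.Unary.All using ([]; _∷_; universal)
open import Data.List.Relation.Unary.All.Properties using (applyUpTo⁺₁; All¬⇒¬Any)
import Data.List.Relation.Unary.AllPairs as AllPairs
open import Data.List.Relation.Unary.AllPairs using (AllPairs; _∷_)
open import Data.List.Relation.Unary.Any using (here; there)
open import Data.List.Relation.Unary.Linked.Properties using (Linked⇒AllPairs)
open import Data.List.Relation.Unary.Unique.Propositional using (Unique)
open import Data.Maybe using (Maybe; nothing; is-just; fromMaybe)
open import Data.Nat using (zero; suc; _+_; _*_; _∸_; _⊓_; _<ᵇ_; z≤n; s≤s; z<s)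
open import Data.Nat.ListAction using (product)
open import Data.Nat.ListAction.Properties using (product-↭)
open import Data.Nat.Properties hiding (_≟_)
open import Algebra.Properties.CommutativeSemigroup +-commutativeSemigroup using (interchange)
open import Data.Nat.Tactic.RingSolver using (solve-∀)
open import Data.Product using (_,_; proj₁; ∃-syntax)
open import Data.Sum using (_⊎_; inj₁; inj₂)
open import Function using (_∘′_; id)
open import Function.Bundles using (Equivalence)
open import Relation.Binary.Definitions using (DecidableEquality; tri<; tri≈; tri>)
open import Relation.Binary.PropositionalEquality using (_≢_; refl; sym; trans; cong; cong₂; subst; module ≡-Reasoning)
open import Relation.Binary.PropositionalEquality.Properties using (setoid)
open import Data.List.Relation.Binary.Permutation.Setoid.Properties (setoid ℕ) using (Unique-resp-↭)
open import Relation.Nullary using (¬_; Dec; yes; no; does; contradiction)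
open import Relation.Unary using (Decidable; _≐_)

module _ {X : Set} {P : X → Set} (P? : Decidable P) where

  length-filter-∷ : ∀ x xs → length (filter P? (x ∷ xs)) ≡ length (filter P? [ x ]) + length (filter P? xs)
  length-filter-∷ x xs = trans (cong length (filter-++ P? [ x ] xs)) (length-++ (filter P? [ x ]))

  length-filter-map : ∀ {W : Set} (f : W → X) ws → length (filter P? (map f ws)) ≡ length (filter (λ w → P? (f w)) ws)
  length-filter-map f []       = refl
  length-filter-map f (w ∷ ws) with does (P? (f w))
  ... | true  = cong suc (length-filter-map f ws)
  ... | false = length-filter-map f ws

  length-filter-concatMap : ∀ {W : Set} (f : W → List X) ws →
    length (filter P? (concatMap f ws)) ≡ sum (map (λ w → length (filter P? (f w))) ws)
  length-filter-concatMap f []       = refl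
  length-filter-concatMap f (w ∷ ws) = trans (cong length (filter-++ P? (f w) (concatMap f ws)))
    (trans (length-++ (filter P? (f w))) (cong (length (filter P? (f w)) +_) (length-filter-concatMap f ws)))

  sum-map-if : ∀ c xs → sum (map (λ x → if does (P? x) then c else 0) xs) ≡ length (filter P? xs) * c
  sum-map-if c []       = refl
  sum-map-if c (x ∷ xs) with does (P? x)
  ... | true  = cong (c +_) (sum-map-if c xs)
  ... | false = sum-map-if c xs

length-filter-≐ : ∀ {X : Set} {P Q : X → Set} (P? : Decidable P) (Q? : Decidable Q) → P ≐ Q →
  ∀ xs → length (filter P? xs) ≡ length (filter Q? xs)
length-filter-≐ P? Q? P≐Q xs = cong length (filter-≐ P? Q? P≐Q xs)

sum-map-+ : ∀ {X : Set} (f g : X → ℕ) xs → sum (map (λ x → f x + g x) xs) ≡ sum (map f xs) + sum (map g xs)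
sum-map-+ f g []       = refl
sum-map-+ f g (x ∷ xs) =
  trans (cong (f x + g x +_) (sum-map-+ f g xs)) (interchange (f x) (g x) (sum (map f xs)) (sum (map g xs)))

sum-map-zero : ∀ {X : Set} (xs : List X) → sum (map (λ _ → 0) xs) ≡ 0
sum-map-zero []       = refl
sum-map-zero (_ ∷ xs) = sum-map-zero xs

module _ {X Y : Set} {R : X → Y → Set} (R? : ∀ x y → Dec (R x y)) where

  sum-length-filter-[_] : ∀ x ys →
    sum (map (λ y → length (filter (λ x′ → R? x′ y) [ x ])) ys) ≡ length (filter (R? x) ys)
  sum-length-filter-[ x ] []       = refl
  sum-length-filter-[ x ] (y ∷ ys) with does (R? x y)
  ... | true  = cong suc (sum-length-filter-[ x ] ys)
  ... | false = sum-length-filter-[ x ] ys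

  sum-length-filter-comm : ∀ xs ys →
    sum (map (λ y → length (filter (λ x → R? x y) xs)) ys) ≡ sum (map (λ x → length (filter (R? x) ys)) xs)
  sum-length-filter-comm []       ys = sum-map-zero ys
  sum-length-filter-comm (x ∷ xs) ys = begin
    sum (map (λ y → length (filter (λ x′ → R? x′ y) (x ∷ xs))) ys)
      ≡⟨ cong sum (map-cong (λ y → length-filter-∷ (λ x′ → R? x′ y) x xs) ys) ⟩
    sum (map (λ y → length (filter (λ x′ → R? x′ y) [ x ]) + length (filter (λ x′ → R? x′ y) xs)) ys)
      ≡⟨ sum-map-+ _ _ ys ⟩
    sum (map (λ y → length (filter (λ x′ → R? x′ y) [ x ])) ys)
      + sum (map (λ y → length (filter (λ x′ → R? x′ y) xs)) ys)
      ≡⟨ cong₂ _+_ (sum-length-filter-[ x ] ys) (sum-length-filter-comm xs ys) ⟩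
    length (filter (R? x) ys) + sum (map (λ x → length (filter (R? x) ys)) xs) ∎
    where open ≡-Reasoning

module _ {X Y : Set} (_≟Y_ : DecidableEquality Y) (f : X → Maybe Y) (ys : List Y) where

  private
    _≟ᴹ_ = MP.≡-dec _≟Y_

  length-filter-is-just : ∀ xs → All (λ x → ∀ y → f x ≡ just y → length (filter (y ≟Y_) ys) ≡ 1) xs →
    length (filter (λ x → T? (is-just (f x))) xs) ≡ sum (map (λ y → length (filter (λ x → f x ≟ᴹ just y) xs)) ys)
  length-filter-is-just xs once = begin
    length (filter (λ x → T? (is-just (f x))) xs)                    ≡⟨ *-identityʳ _ ⟨
    length (filter (λ x → T? (is-just (f x))) xs) * 1                ≡⟨ sum-map-if (λ x → T? (is-just (f x))) 1 xs ⟨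
    sum (map (λ x → if does (T? (is-just (f x))) then 1 else 0) xs) ≡⟨ cong sum (map-cong-local (All.map fibre-size once)) ⟩
    sum (map (λ x → length (filter (λ y → f x ≟ᴹ just y) ys)) xs)    ≡⟨ sum-length-filter-comm (λ x y → f x ≟ᴹ just y) xs ys ⟨
    sum (map (λ y → length (filter (λ x → f x ≟ᴹ just y) xs)) ys)    ∎
    where
    open ≡-Reasoning
    fibre-size : ∀ {x} → (∀ y → f x ≡ just y → length (filter (y ≟Y_) ys) ≡ 1) →
      (if does (T? (is-just (f x))) then 1 else 0) ≡ length (filter (λ y → f x ≟ᴹ just y) ys)
    fibre-size {x} once-x with f x
    ... | nothing = sym (cong length (filter-none (λ y → nothing ≟ᴹ just y) (universal (λ _ ()) ys)))
    ... | just y₀ = sym (trans (length-filter-≐ _ (y₀ ≟Y_) (MP.just-injective , cong just) ys) (once-x y₀ refl))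

applyUpTo-+ : ∀ {X : Set} (f : ℕ → X) m n → applyUpTo f (m + n) ≡ applyUpTo f m ++ applyUpTo (λ x → f (m + x)) n
applyUpTo-+ f zero    n = refl
applyUpTo-+ f (suc m) n = cong (f 0 ∷_) (applyUpTo-+ (λ x → f (suc x)) m n)

module _ {P : ℕ → Set} (P? : Decidable P) where

  length-filter-applyUpTo-window : ∀ (f : ℕ → ℕ) p m q →
    (∀ {x} → x < p → ¬ P (f x)) → (∀ {x} → x < m → P (f (p + x))) → (∀ {x} → x < q → ¬ P (f (p + m + x))) →
    length (filter P? (applyUpTo f (p + m + q))) ≡ m
  length-filter-applyUpTo-window f p m q before inside after = begin
    length (filter P? (applyUpTo f (p + m + q)))
      ≡⟨ cong (length ∘′ filter P?) (trans (applyUpTo-+ f (p + m) q) (cong (_++ ys) (applyUpTo-+ f p m))) ⟩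
    length (filter P? ((xs ++ window) ++ ys))
      ≡⟨ cong length (trans (filter-++ P? (xs ++ window) ys) (cong (_++ filter P? ys) (filter-++ P? xs window))) ⟩
    length ((filter P? xs ++ filter P? window) ++ filter P? ys)
      ≡⟨ cong₂ (λ xs′ ys′ → length ((xs′ ++ filter P? window) ++ ys′))
           (filter-none P? (applyUpTo⁺₁ f p before)) (filter-none P? (applyUpTo⁺₁ _ q after)) ⟩
    length (filter P? window ++ [])
      ≡⟨ cong (λ zs → length (zs ++ [])) (filter-all P? (applyUpTo⁺₁ _ m inside)) ⟩
    length (window ++ [])
      ≡⟨ cong length (++-identityʳ window) ⟩
    length window
      ≡⟨ length-applyUpTo _ m ⟩
    m ∎
    where
    open ≡-Reasoning
    xs window ys : List ℕ
    xs     = applyUpTo f p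
    window = applyUpTo (λ x → f (p + x)) m
    ys     = applyUpTo (λ x → f (p + m + x)) q

s≤s-+-suc : ∀ {m n k} → m ≤ n + k → suc m ≤ n + suc k
s≤s-+-suc {n = n} {k} m≤n+k = ≤-trans (s≤s m≤n+k) (≤-reflexive (sym (+-suc n k)))

≤-pred-+-suc : ∀ {m n k} → suc m ≤ n + suc k → m ≤ n + k
≤-pred-+-suc {n = n} {k} 1+m≤n+1+k = ≤-pred (≤-trans 1+m≤n+1+k (≤-reflexive (+-suc n k)))

m+1+n≡o⇒m<o : ∀ {m n o} → m + suc n ≡ o → m < o
m+1+n≡o⇒m<o {m} refl = m<m+n m z<s

m<n∸o⇒m+o<n : ∀ {m n o} → m < n ∸ o → m + o < n
m<n∸o⇒m+o<n {m} {n}     {zero}  m<n   = subst (_< n) (sym (+-identityʳ m)) m<n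
m<n∸o⇒m+o<n {m} {suc n} {suc o} m<n∸o = subst (_< suc n) (sym (+-suc m o)) (s≤s (m<n∸o⇒m+o<n m<n∸o))

module _ {a d lo L : ℕ} (k : ℕ) (a+1+d≡lo+1+L : a + suc d ≡ lo + suc L) where

  private
    shuffle : lo + k + suc d ≡ lo + suc (d + k)
    shuffle = trans (+-assoc lo k (suc d)) (cong (lo +_) (+-comm k (suc d)))

  d+k<L⇒lo+k<a : d + k < L → lo + k < a
  d+k<L⇒lo+k<a d+k<L = +-cancelʳ-< (suc d) (lo + k) a
    (≤-trans (≤-reflexive (cong suc shuffle)) (≤-trans (+-monoʳ-< lo (s≤s d+k<L)) (≤-reflexive (sym a+1+d≡lo+1+L))))

  lo+k<a⇒d+k<L : lo + k < a → d + k < L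
  lo+k<a⇒d+k<L lo+k<a = ≤-pred (+-cancelˡ-< lo (suc (d + k)) (suc L)
    (≤-trans (≤-reflexive (cong suc (sym shuffle))) (≤-trans (+-monoˡ-< (suc d) lo+k<a) (≤-reflexive a+1+d≡lo+1+L))))

Occupied : Street → ℕ → ℕ → Set
Occupied st lo hi = ∀ u → lo < u → u < hi → free st u ≡ false

≡true⇒≢false : ∀ {b} → b ≡ true → b ≢ false
≡true⇒≢false refl ()

module _ (st : Street) where

  Occupied-sucʳ : ∀ {lo hi} → Occupied st lo hi → free st hi ≡ false → Occupied st lo (suc hi)
  Occupied-sucʳ occupied full-hi u lo<u u<1+hi with m<1+n⇒m<n∨m≡n u<1+hi
  ... | inj₁ u<hi = occupied u lo<u u<hi
  ... | inj₂ refl = full-hi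

  Occupied-predˡ : ∀ {lo hi} → free st (suc lo) ≡ false → Occupied st (suc lo) hi → Occupied st lo hi
  Occupied-predˡ full-1+lo occupied u lo<u u<hi with m≤n⇒m<n∨m≡n lo<u
  ... | inj₁ 1+lo<u = occupied u 1+lo<u u<hi
  ... | inj₂ refl   = full-1+lo

  Occupied-⊆ : ∀ {lo hi lo′ hi′} → lo ≤ lo′ → hi′ ≤ hi → Occupied st lo hi → Occupied st lo′ hi′
  Occupied-⊆ lo≤lo′ hi′≤hi occupied u lo′<u u<hi′ = occupied u (≤-<-trans lo≤lo′ lo′<u) (<-≤-trans u<hi′ hi′≤hi)

  Occupied-rightOf : ∀ i n → (∀ e → e < n → free st (suc (i + e)) ≡ false) → Occupied st i (suc (i + n))
  Occupied-rightOf i n full u i<u u<1+i+n with e , 1+i+e≡u ← m≤n⇒∃[o]m+o≡n i<u =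
    subst (λ v → free st v ≡ false) 1+i+e≡u
      (full e (+-cancelˡ-< (suc i) e n (≤-trans (≤-reflexive (cong suc 1+i+e≡u)) u<1+i+n)))

  Occupied-leftOf : ∀ lo n i → lo + suc n ≡ i → (∀ d u → d < n → u + suc d ≡ i → free st u ≡ false) → Occupied st lo i
  Occupied-leftOf lo n i lo+1+n≡i full u lo<u u<i with d , 1+u+d≡i ← m≤n⇒∃[o]m+o≡n u<i = full d u d<n u+1+d≡i
    where
    u+1+d≡i = trans (+-suc u d) 1+u+d≡i
    d<n = ≤-pred (+-cancelˡ-< lo (suc d) (suc n)
      (≤-trans (+-monoˡ-< (suc d) lo<u) (≤-reflexive (trans u+1+d≡i (sym lo+1+n≡i)))))

  backSearch-just⇒ : ∀ p k s → backSearch st p k ≡ just s → s < p × p ≤ s + k × free st s ≡ true × Occupied st s p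
  backSearch-just⇒ (suc p) (suc k) s found with free st p in free-p
  ... | true with refl ← found =
    ≤-refl , s≤s-+-suc (m≤m+n p k) , free-p , λ u p<u u<1+p → contradiction (≤-pred u<1+p) (<⇒≱ p<u)
  ... | false with backSearch-just⇒ p k s found
  ...   | s<p , p≤s+k , free-s , occupied = m<n⇒m<1+n s<p , s≤s-+-suc p≤s+k , free-s , Occupied-sucʳ occupied free-p

  backSearch-just⇐ : ∀ p k s → s < p → p ≤ s + k → free st s ≡ true → Occupied st s p → backSearch st p k ≡ just s
  backSearch-just⇐ (suc p) zero    s s<1+p 1+p≤s+0 _ _ =
    contradiction (≤-trans 1+p≤s+0 (≤-reflexive (+-identityʳ s))) (<⇒≱ s<1+p)
  backSearch-just⇐ (suc p) (suc k) s s<1+p 1+p≤s+1+k free-s occupied with m<1+n⇒m<n∨m≡n s<1+p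
  ... | inj₂ refl rewrite free-s = refl
  ... | inj₁ s<p rewrite occupied p s<p ≤-refl =
    backSearch-just⇐ p k s s<p (≤-pred-+-suc 1+p≤s+1+k) free-s (Occupied-⊆ ≤-refl (n≤1+n p) occupied)

  backSearch-nothing⇒ : ∀ p k → backSearch st p k ≡ nothing → ∀ u → u < p → p ≤ u + k → free st u ≡ false
  backSearch-nothing⇒ p       zero    _    u u<p p≤u+0 =
    contradiction (≤-trans p≤u+0 (≤-reflexive (+-identityʳ u))) (<⇒≱ u<p)
  backSearch-nothing⇒ (suc p) (suc k) none u u<1+p 1+p≤u+1+k with free st p in free-p
  ... | false with m<1+n⇒m<n∨m≡n u<1+p
  ...   | inj₁ u<p  = backSearch-nothing⇒ p k none u u<p (≤-pred-+-suc 1+p≤u+1+k)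
  ...   | inj₂ refl = free-p

  backSearch-nothing⇐ : ∀ p k → (∀ u → u < p → p ≤ u + k → free st u ≡ false) → backSearch st p k ≡ nothing
  backSearch-nothing⇐ p       zero    _    = refl
  backSearch-nothing⇐ zero    (suc k) _    = refl
  backSearch-nothing⇐ (suc p) (suc k) full rewrite full p ≤-refl (s≤s-+-suc (m≤m+n p k)) =
    backSearch-nothing⇐ p k (λ u u<p p≤u+k → full u (m<n⇒m<1+n u<p) (s≤s-+-suc p≤u+k))

  fwdSearch-just⇒ : ∀ p ℓ s → fwdSearch st p ℓ ≡ just s → p < s × s ≤ p + ℓ × free st s ≡ true × Occupied st p s
  fwdSearch-just⇒ p (suc ℓ) s found with free st (suc p) in free-1+p
  ... | true with refl ← found =
    ≤-refl , s≤s-+-suc (m≤m+n p ℓ) , free-1+p , λ u p<u u<1+p → contradiction (≤-pred u<1+p) (<⇒≱ p<u)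
  ... | false with fwdSearch-just⇒ (suc p) ℓ s found
  ...   | 1+p<s , s≤1+p+ℓ , free-s , occupied =
    <-trans (n<1+n p) 1+p<s , ≤-trans s≤1+p+ℓ (≤-reflexive (sym (+-suc p ℓ))) , free-s ,
    Occupied-predˡ free-1+p occupied

  fwdSearch-just⇐ : ∀ p ℓ s → p < s → s ≤ p + ℓ → free st s ≡ true → Occupied st p s → fwdSearch st p ℓ ≡ just s
  fwdSearch-just⇐ p zero    s p<s s≤p+0 _ _ = contradiction (≤-trans s≤p+0 (≤-reflexive (+-identityʳ p))) (<⇒≱ p<s)
  fwdSearch-just⇐ p (suc ℓ) s p<s s≤p+1+ℓ free-s occupied with m≤n⇒m<n∨m≡n p<s
  ... | inj₂ refl rewrite free-s = refl
  ... | inj₁ 1+p<s rewrite occupied (suc p) ≤-refl 1+p<s =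
    fwdSearch-just⇐ (suc p) ℓ s 1+p<s (≤-trans s≤p+1+ℓ (≤-reflexive (+-suc p ℓ))) free-s
      (Occupied-⊆ (n≤1+n p) ≤-refl occupied)

data ChosenBy (k ℓ : ℕ) (st : Street) (a s : ℕ) : Set where
  preferred : free st a ≡ true → a ≡ s → ChosenBy k ℓ st a s
  backward  : free st a ≡ false → backSearch st a k ≡ just s → ChosenBy k ℓ st a s
  forward   : free st a ≡ false → backSearch st a k ≡ nothing → fwdSearch st a ℓ ≡ just s → ChosenBy k ℓ st a s

module _ (k ℓ : ℕ) (st : Street) where

  chooseSpot-preferred : ∀ a → free st a ≡ true → chooseSpot k ℓ st a ≡ just a
  chooseSpot-preferred a free-a rewrite free-a = refl

  chooseSpot-backward : ∀ a s → free st a ≡ false → backSearch st a k ≡ just s → chooseSpot k ℓ st a ≡ just s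
  chooseSpot-backward a s full-a back rewrite full-a | back = refl

  chooseSpot-forward : ∀ a → free st a ≡ false → backSearch st a k ≡ nothing → chooseSpot k ℓ st a ≡ fwdSearch st a ℓ
  chooseSpot-forward a full-a none rewrite full-a | none = refl

  chooseSpot-just⇒ : ∀ a s → chooseSpot k ℓ st a ≡ just s → ChosenBy k ℓ st a s
  chooseSpot-just⇒ a s chosen with free st a in free-a
  ... | true with refl ← chosen = preferred free-a refl
  ... | false with backSearch st a k in back
  ...   | just _ with refl ← chosen = backward free-a back
  ...   | nothing = forward free-a back chosen

  chooseSpot-free : ∀ a s → chooseSpot k ℓ st a ≡ just s → free st s ≡ true
  chooseSpot-free a s chosen with chooseSpot-just⇒ a s chosen
  ... | preferred free-a refl = free-a
  ... | backward _ back with _ , _ , free-s , _ ← backSearch-just⇒ st a k s back = free-s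
  chooseSpot-free a s chosen | forward _ _ fwd with _ , _ , free-s , _ ← fwdSearch-just⇒ st a ℓ s fwd = free-s

-- The preferences that park a car in a given free spot

preferencesInto : (k ℓ t : ℕ) → Street → ℕ → ℕ
preferencesInto k ℓ t st s = length (filter (λ a → MP.≡-dec _≟_ (chooseSpot k ℓ st a) (just s)) (map suc (upTo t)))

record Runs (st : Street) (t i R L : ℕ) : Set where
  field
    free-i         : free st i ≡ true
    right-occupied : Occupied st i (suc (i + R))
    right-bounded  : i + R ≤ t
    right-maximal  : i + R < t → free st (suc (i + R)) ≡ true
    left-end       : ℕ
    left-end+1+L≡i : left-end + suc L ≡ i
    left-occupied  : Occupied st left-end i
    free-left-end  : free st left-end ≡ true

module Window {st : Street} {t i R L : ℕ} (runs : Runs st t i R L) (k ℓ : ℕ) where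

  open Runs runs renaming (left-end to lo; left-end+1+L≡i to lo+1+L≡i)

  Bᵢ Fᵢ : ℕ
  Bᵢ = R ⊓ k
  Fᵢ = (L ∸ k) ⊓ ℓ

  chooseSpot-right-of : ∀ e → e < Bᵢ → chooseSpot k ℓ st (suc (i + e)) ≡ just i
  chooseSpot-right-of e e<B = chooseSpot-backward k ℓ st (suc (i + e)) i
    (right-occupied (suc (i + e)) i<a (s≤s (+-monoʳ-< i e<R)))
    (backSearch-just⇐ st (suc (i + e)) k i i<a a≤i+k free-i
      (Occupied-⊆ st ≤-refl (s≤s (+-monoʳ-≤ i (<⇒≤ e<R))) right-occupied))
    where
    e<R = <-≤-trans e<B (m⊓n≤m R k)
    i<a = s≤s (m≤m+n i e)
    a≤i+k = ≤-trans (≤-reflexive (sym (+-suc i e))) (+-monoʳ-≤ i (<-≤-trans e<B (m⊓n≤n R k)))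

  chooseSpot-left-of : ∀ a d → a + suc d ≡ i → suc d ≤ Fᵢ → chooseSpot k ℓ st a ≡ just i
  chooseSpot-left-of a d a+1+d≡i 1+d≤F = trans (chooseSpot-forward k ℓ st a full-a none)
    (fwdSearch-just⇐ st a ℓ i a<i i≤a+ℓ free-i (Occupied-⊆ st (<⇒≤ lo<a) ≤-refl left-occupied))
    where
    a<i = m+1+n≡o⇒m<o a+1+d≡i
    lo+k<a = d+k<L⇒lo+k<a k (trans a+1+d≡i (sym lo+1+L≡i)) (m<n∸o⇒m+o<n (≤-trans 1+d≤F (m⊓n≤m (L ∸ k) ℓ)))
    lo<a = ≤-<-trans (m≤m+n lo k) lo+k<a
    full-a = left-occupied a lo<a a<i
    none = backSearch-nothing⇐ st a k λ u u<a a≤u+k →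
      left-occupied u (+-cancelʳ-< k lo u (<-≤-trans lo+k<a a≤u+k)) (<-trans u<a a<i)
    i≤a+ℓ = ≤-trans (≤-reflexive (sym a+1+d≡i)) (+-monoʳ-≤ a (≤-trans 1+d≤F (m⊓n≤n (L ∸ k) ℓ)))

  chooseSpot-too-far-left : ∀ a d → a + suc d ≡ i → Fᵢ < suc d → chooseSpot k ℓ st a ≢ just i
  chooseSpot-too-far-left a d a+1+d≡i F<1+d chosen with chooseSpot-just⇒ k ℓ st a i chosen
  ... | preferred _ a≡i = <-irrefl a≡i (m+1+n≡o⇒m<o a+1+d≡i)
  ... | backward _ back = <-asym (proj₁ (backSearch-just⇒ st a k i back)) (m+1+n≡o⇒m<o a+1+d≡i)
  ... | forward full-a none fwd with fwdSearch-just⇒ st a ℓ i fwd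
  ...   | a<i , i≤a+ℓ , _ , occupied with <-cmp lo a
  ...     | tri< lo<a _ _ = ≡true⇒≢false free-left-end (backSearch-nothing⇒ st a k none lo lo<a a≤lo+k)
    where
    1+d≤ℓ = +-cancelˡ-≤ a (suc d) ℓ (≤-trans (≤-reflexive a+1+d≡i) i≤a+ℓ)
    a≤lo+k = ≮⇒≥ λ lo+k<a → <⇒≱ F<1+d
      (⊓-glb (m+n≤o⇒m≤o∸n (suc d) (lo+k<a⇒d+k<L k (trans a+1+d≡i (sym lo+1+L≡i)) lo+k<a)) 1+d≤ℓ)
  ...     | tri≈ _ refl _ = ≡true⇒≢false free-left-end full-a
  ...     | tri> _ _ a<lo = ≡true⇒≢false free-left-end (occupied lo a<lo (m+1+n≡o⇒m<o lo+1+L≡i))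

  chooseSpot-too-far-right : ∀ e → Bᵢ ≤ e → suc (i + e) ≤ t → chooseSpot k ℓ st (suc (i + e)) ≢ just i
  chooseSpot-too-far-right e B≤e a≤t chosen with chooseSpot-just⇒ k ℓ st (suc (i + e)) i chosen
  ... | preferred _ a≡i = m≢1+m+n i (sym a≡i)
  ... | forward _ _ fwd = <-asym (proj₁ (fwdSearch-just⇒ st (suc (i + e)) ℓ i fwd)) (s≤s (m≤m+n i e))
  ... | backward full-a back with backSearch-just⇒ st (suc (i + e)) k i back
  ...   | _ , a≤i+k , _ , occupied with m≤n⇒m<n∨m≡n R≤e
    where
    e<k = +-cancelˡ-≤ i (suc e) k (≤-trans (≤-reflexive (+-suc i e)) a≤i+k)
    R≤e = ≮⇒≥ λ e<R → <⇒≱ (⊓-glb e<R e<k) B≤e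
  ...     | inj₁ R<e  = ≡true⇒≢false (right-maximal i+R<t)
                          (occupied (suc (i + R)) (s≤s (m≤m+n i R)) (s≤s (+-monoʳ-< i R<e)))
    where i+R<t = ≤-trans (s≤s (+-monoʳ-≤ i (<⇒≤ R<e))) a≤t
  ...     | inj₂ refl = ≡true⇒≢false (right-maximal a≤t) full-a

  -- The preferences 1, …, t are 1, …, p, then the window i-Fᵢ, …, i+Bᵢ, then q more.
  p q : ℕ
  p = i ∸ suc Fᵢ
  q = t ∸ (i + Bᵢ)

  private
    p+1+F≡i : p + suc Fᵢ ≡ i
    p+1+F≡i = m∸n+n≡m
      (≤-trans (s≤s (≤-trans (m⊓n≤m _ ℓ) (m∸n≤m L k))) (≤-trans (m≤n+m (suc L) lo) (≤-reflexive lo+1+L≡i)))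

    i+B+q≡t : i + Bᵢ + q ≡ t
    i+B+q≡t = m+[n∸m]≡n (≤-trans (+-monoʳ-≤ i (m⊓n≤m R k)) right-bounded)

    split : ∀ m F B n → m + (F + suc B) + n ≡ m + suc F + B + n
    split = solve-∀
    shift-before : ∀ x y F → suc x + suc (y + F) ≡ suc x + y + suc F
    shift-before = solve-∀
    shift-left : ∀ m x y → suc (m + x) + suc y ≡ m + suc (suc x + y)
    shift-left = solve-∀
    shift-right : ∀ m F e → suc (m + (suc F + e)) ≡ suc (m + suc F + e)
    shift-right = solve-∀
    shift-after : ∀ m F B x → suc (m + (F + suc B) + x) ≡ suc (m + suc F + (B + x))
    shift-after = solve-∀

  t≡p+window+q : t ≡ p + (Fᵢ + suc Bᵢ) + q
  t≡p+window+q = sym (trans (split p Fᵢ Bᵢ q) (trans (cong (λ j → j + Bᵢ + q) p+1+F≡i) i+B+q≡t))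

  chooseSpot-before-window : ∀ {x} → x < p → chooseSpot k ℓ st (suc x) ≢ just i
  chooseSpot-before-window {x} x<p with y , 1+x+y≡p ← m≤n⇒∃[o]m+o≡n x<p =
    chooseSpot-too-far-left (suc x) (y + Fᵢ)
      (trans (shift-before x y Fᵢ) (trans (cong (_+ suc Fᵢ) 1+x+y≡p) p+1+F≡i)) (s≤s (m≤n+m Fᵢ y))

  chooseSpot-in-window : ∀ {x} → x < Fᵢ + suc Bᵢ → chooseSpot k ℓ st (suc (p + x)) ≡ just i
  chooseSpot-in-window {x} x<F+1+B with <-cmp x Fᵢ
  ... | tri< x<F _ _ with y , 1+x+y≡F ← m≤n⇒∃[o]m+o≡n x<F =
    chooseSpot-left-of (suc (p + x)) y
      (trans (shift-left p x y) (trans (cong (λ j → p + suc j) 1+x+y≡F) p+1+F≡i))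
      (≤-trans (s≤s (m≤n+m y x)) (≤-reflexive 1+x+y≡F))
  ... | tri≈ _ refl _ =
    subst (λ a → chooseSpot k ℓ st a ≡ just i) (trans (sym p+1+F≡i) (+-suc p Fᵢ))
      (chooseSpot-preferred k ℓ st i free-i)
  ... | tri> _ _ F<x with e , 1+F+e≡x ← m≤n⇒∃[o]m+o≡n F<x =
    subst (λ a → chooseSpot k ℓ st a ≡ just i) a≡1+p+x (chooseSpot-right-of e e<B)
    where
    a≡1+p+x = sym
      (trans (cong (λ j → suc (p + j)) (sym 1+F+e≡x)) (trans (shift-right p Fᵢ e) (cong (λ j → suc (j + e)) p+1+F≡i)))
    e<B = +-cancelˡ-< (suc Fᵢ) e Bᵢ
      (≤-trans (≤-reflexive (cong suc 1+F+e≡x)) (≤-trans x<F+1+B (≤-reflexive (+-suc Fᵢ Bᵢ))))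

  chooseSpot-after-window : ∀ {x} → x < q → chooseSpot k ℓ st (suc (p + (Fᵢ + suc Bᵢ) + x)) ≢ just i
  chooseSpot-after-window {x} x<q chosen =
    chooseSpot-too-far-right (Bᵢ + x) (m≤m+n Bᵢ x) a≤t (subst (λ a → chooseSpot k ℓ st a ≡ just i) a≡1+i+B+x chosen)
    where
    a≡1+i+B+x = trans (shift-after p Fᵢ Bᵢ x) (cong (λ j → suc (j + (Bᵢ + x))) p+1+F≡i)
    a≤t = ≤-trans (≤-reflexive (cong suc (sym (+-assoc i Bᵢ x))))
      (≤-trans (+-monoʳ-< (i + Bᵢ) x<q) (≤-reflexive i+B+q≡t))

  preferencesInto≡B+F+1 : preferencesInto k ℓ t st i ≡ Bᵢ + Fᵢ + 1
  preferencesInto≡B+F+1 = begin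
    length (filter chosen? (map suc (upTo t)))
      ≡⟨ cong (length ∘′ filter chosen?) (trans (map-applyUpTo id suc t) (cong (applyUpTo suc) t≡p+window+q)) ⟩
    length (filter chosen? (applyUpTo suc (p + (Fᵢ + suc Bᵢ) + q)))
      ≡⟨ length-filter-applyUpTo-window chosen? suc p (Fᵢ + suc Bᵢ) q
           chooseSpot-before-window chooseSpot-in-window chooseSpot-after-window ⟩
    Fᵢ + suc Bᵢ
      ≡⟨ reorder Fᵢ Bᵢ ⟩
    Bᵢ + Fᵢ + 1 ∎
    where
    open ≡-Reasoning
    chosen? : ∀ a → Dec (chooseSpot k ℓ st a ≡ just i)
    chosen? a = MP.≡-dec _≟_ (chooseSpot k ℓ st a) (just i)
    reorder : ∀ F B → F + suc B ≡ B + F + 1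
    reorder = solve-∀

-- The street seen by each car

at-drop : ∀ m xs d → at (drop m xs) d ≡ at xs (m + d)
at-drop zero    xs       d = refl
at-drop (suc m) []       d = refl
at-drop (suc m) (x ∷ xs) d = at-drop m xs d

at-take : ∀ j xs u → u < j → at (take j xs) u ≡ at xs u
at-take (suc j) []       u       _         = refl
at-take (suc j) (x ∷ xs) zero    _         = refl
at-take (suc j) (x ∷ xs) (suc u) (s≤s u<j) = at-take j xs u u<j

at-++ˡ : ∀ xs ys d → d < length xs → at (xs ++ ys) d ≡ at xs d
at-++ˡ (x ∷ xs) ys zero    _         = refl
at-++ˡ (x ∷ xs) ys (suc d) (s≤s d<n) = at-++ˡ xs ys d d<n

at-∷ʳ-length : ∀ xs y → at (xs ∷ʳ y) (length xs) ≡ y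
at-∷ʳ-length []       y = refl
at-∷ʳ-length (x ∷ xs) y = at-∷ʳ-length xs y

at-reverse : ∀ xs u d → u + suc d ≡ length xs → at (reverse xs) d ≡ at xs u
at-reverse []       u       d eq = contradiction (trans (sym (+-suc u d)) eq) λ ()
at-reverse (x ∷ xs) zero    d eq rewrite unfold-reverse x xs =
  subst (λ n → at (reverse xs ∷ʳ x) n ≡ x) (trans (length-reverse xs) (sym (suc-injective eq)))
    (at-∷ʳ-length (reverse xs) x)
at-reverse (x ∷ xs) (suc u) d eq rewrite unfold-reverse x xs =
  trans (at-++ˡ (reverse xs) [ x ] d (≤-trans d<n (≤-reflexive (sym (length-reverse xs)))))
    (at-reverse xs u d (suc-injective eq))
  where
  d<n : d < length xs
  d<n = ≤-trans (s≤s (m≤n+m d u)) (≤-reflexive (trans (sym (+-suc u d)) (suc-injective eq)))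

at-All : ∀ {P : ℕ → Set} xs u → All P xs → u < length xs → P (at xs u)
at-All (x ∷ xs) zero    (px ∷ _)   _         = px
at-All (x ∷ xs) (suc u) (_  ∷ pxs) (s≤s u<n) = at-All xs u pxs u<n

module _ (p : ℕ → Bool.Bool) where

  takeWhileᵇ-length≤ : ∀ xs → length (takeWhileᵇ p xs) ≤ length xs
  takeWhileᵇ-length≤ []       = z≤n
  takeWhileᵇ-length≤ (x ∷ xs) with p x
  ... | true  = s≤s (takeWhileᵇ-length≤ xs)
  ... | false = z≤n

  takeWhileᵇ-at : ∀ xs d → d < length (takeWhileᵇ p xs) → p (at xs d) ≡ true
  takeWhileᵇ-at (x ∷ xs) d       d<n with p x in px
  takeWhileᵇ-at (x ∷ xs) zero    _         | true = px
  takeWhileᵇ-at (x ∷ xs) (suc d) (s≤s d<n) | true = takeWhileᵇ-at xs d d<n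

  takeWhileᵇ-stop : ∀ xs → length (takeWhileᵇ p xs) < length xs → p (at xs (length (takeWhileᵇ p xs))) ≡ false
  takeWhileᵇ-stop (x ∷ xs) n<len with p x in px
  ... | true  = takeWhileᵇ-stop xs (≤-pred n<len)
  ... | false = px

<ᵇ≡true : ∀ {m n} → m < n → (m <ᵇ n) ≡ true
<ᵇ≡true m<n = Equivalence.to T-≡ (<⇒<ᵇ m<n)

<ᵇ≡false : ∀ {m n} → ¬ m < n → (m <ᵇ n) ≡ false
<ᵇ≡false {m} {n} m≮n with m <ᵇ n in m<ᵇn
... | false = refl
... | true  = contradiction (<ᵇ⇒< m n (Equivalence.from T-≡ m<ᵇn)) m≮n

occupantBefore : ℕ → ℕ → Maybe ℕ
occupantBefore c v = if v <ᵇ c then just v else nothing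

streetBefore : ℕ → List ℕ → Street
streetBefore c ρ = nothing ∷ map (occupantBefore c) ρ

free-streetBefore : ∀ c ρ u → u < length ρ → free (streetBefore c ρ) (suc u) ≡ not (at ρ u <ᵇ c)
free-streetBefore c (v ∷ ρ) zero    _         with v <ᵇ c
... | true  = refl
... | false = refl
free-streetBefore c (v ∷ ρ) (suc u) (s≤s u<n) = free-streetBefore c ρ u u<n

module _ (ρ : List ℕ) (positive : All (0 <_) ρ) (j : ℕ) (j<t : j < length ρ) where

  private
    t c R L : ℕ
    t = length ρ
    c = at ρ j
    R = Right (0 ∷ ρ) (suc j)
    L = Left (0 ∷ ρ) (suc j)
    st : Street
    st = streetBefore c ρ
    below-c positive-below-c : ℕ → Bool.Bool
    below-c v = v <ᵇ c
    positive-below-c v = (0 <ᵇ v) ∧ (v <ᵇ c)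
    leftward : List ℕ
    leftward = reverse (0 ∷ take j ρ)

    length-take-j : length (take j ρ) ≡ j
    length-take-j = trans (length-take j ρ) (m≤n⇒m⊓n≡m (<⇒≤ j<t))

    at-leftward : ∀ u d → u + suc d ≡ suc j → at leftward d ≡ at (0 ∷ take j ρ) u
    at-leftward u d eq = at-reverse (0 ∷ take j ρ) u d (trans eq (sym (cong suc length-take-j)))

    at-leftward-suc : ∀ u d → suc u + suc d ≡ suc j → u < j × at leftward d ≡ at ρ u
    at-leftward-suc u d eq = u<j , trans (at-leftward (suc u) d eq) (at-take j ρ u u<j)
      where u<j = ≤-trans (m<m+n u z<s) (≤-reflexive (suc-injective eq))

    positive-below-c≡below-c : ∀ u → u < t → positive-below-c (at ρ u) ≡ below-c (at ρ u)
    positive-below-c≡below-c u u<t = cong (_∧ below-c (at ρ u)) (<ᵇ≡true (at-All ρ u positive u<t))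

    free-c : free st (suc j) ≡ true
    free-c = trans (free-streetBefore c ρ j j<t) (cong not (<ᵇ≡false {c} (<-irrefl refl)))

    1+j+R≤t : suc j + R ≤ t
    1+j+R≤t = ≤-trans
      (+-monoʳ-≤ (suc j) (≤-trans (takeWhileᵇ-length≤ below-c (drop (suc j) ρ)) (≤-reflexive (length-drop (suc j) ρ))))
                      (≤-reflexive (m+[n∸m]≡n j<t))

    right-full : ∀ e → e < R → free st (suc (suc j + e)) ≡ false
    right-full e e<R = trans (free-streetBefore c ρ (suc j + e) (<-≤-trans (+-monoʳ-< (suc j) e<R) 1+j+R≤t))
      (cong not (trans (sym (cong below-c (at-drop (suc j) ρ e))) (takeWhileᵇ-at below-c (drop (suc j) ρ) e e<R)))

    right-end-free : suc j + R < t → free st (suc (suc j + R)) ≡ true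
    right-end-free 1+j+R<t = trans (free-streetBefore c ρ (suc j + R) 1+j+R<t)
      (cong not (trans (sym (cong below-c (at-drop (suc j) ρ R))) (takeWhileᵇ-stop below-c (drop (suc j) ρ) R<len)))
      where
      R<len : R < length (drop (suc j) ρ)
      R<len = ≤-trans (+-cancelˡ-< (suc j) R (t ∸ suc j) (≤-trans 1+j+R<t (≤-reflexive (sym (m+[n∸m]≡n j<t)))))
                      (≤-reflexive (sym (length-drop (suc j) ρ)))

    left-full : ∀ d u → d < L → u + suc d ≡ suc j → free st u ≡ false
    left-full d zero    d<L eq
      with () ← trans (sym (cong positive-below-c (at-leftward zero d eq)))
        (takeWhileᵇ-at positive-below-c leftward d d<L)
    left-full d (suc u) d<L eq with u<j , at-d ← at-leftward-suc u d eq =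
      trans (free-streetBefore c ρ u (<-trans u<j j<t))
        (cong not (trans (sym (positive-below-c≡below-c u (<-trans u<j j<t)))
        (trans (sym (cong positive-below-c at-d)) (takeWhileᵇ-at positive-below-c leftward d d<L))))

    L≤j : L ≤ j
    L≤j = ≮⇒≥ λ j<L → 0-not-positive (trans (sym (cong positive-below-c (at-leftward zero j refl)))
                                             (takeWhileᵇ-at positive-below-c leftward j j<L))
      where
      0-not-positive : positive-below-c 0 ≢ true
      0-not-positive ()

    left-end-free : ∀ u → u + suc L ≡ suc j → free st u ≡ true
    left-end-free zero    _  = refl
    left-end-free (suc u) eq with u<j , at-L ← at-leftward-suc u L eq =
      trans (free-streetBefore c ρ u (<-trans u<j j<t))
        (cong not (trans (sym (positive-below-c≡below-c u (<-trans u<j j<t)))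
        (trans (sym (cong positive-below-c at-L)) (takeWhileᵇ-stop positive-below-c leftward L<length))))
      where
      L<length : L < length leftward
      L<length = ≤-trans (s≤s L≤j)
        (≤-reflexive (sym (trans (length-reverse (0 ∷ take j ρ)) (cong suc length-take-j))))

    lo+1+L≡1+j : j ∸ L + suc L ≡ suc j
    lo+1+L≡1+j = trans (+-suc (j ∸ L) L) (cong suc (m∸n+n≡m L≤j))

  runs-streetBefore : Runs (streetBefore (at ρ j) ρ) (length ρ) (suc j) (Right (0 ∷ ρ) (suc j)) (Left (0 ∷ ρ) (suc j))
  runs-streetBefore = record
    { free-i         = free-c
    ; right-occupied = Occupied-rightOf st (suc j) R right-full
    ; right-bounded  = 1+j+R≤t
    ; right-maximal  = right-end-free
    ; left-end       = j ∸ L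
    ; left-end+1+L≡i = lo+1+L≡1+j
    ; left-occupied  = Occupied-leftOf st (j ∸ L) L (suc j) lo+1+L≡1+j left-full
    ; free-left-end  = left-end-free (j ∸ L) lo+1+L≡1+j
    }

finalStreet : List ℕ → Street
finalStreet ρ = nothing ∷ map just ρ

occupant : Street → ℕ → Maybe ℕ
occupant []       _       = nothing
occupant (o ∷ _)  zero    = o
occupant (_ ∷ st) (suc u) = occupant st u

occupant-place : ∀ st s c → free st s ≡ true → occupant (place st s c) s ≡ just c
occupant-place (o ∷ st) zero    c _      = refl
occupant-place (o ∷ st) (suc s) c free-s = occupant-place st s c free-s

occupant-place-occupied : ∀ st s u c x → free st s ≡ true → occupant st u ≡ just x →
  occupant (place st s c) u ≡ just x
occupant-place-occupied (nothing ∷ st) zero    zero    c x _      ()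
occupant-place-occupied (o ∷ st)       zero    (suc u) c x _      at-u = at-u
occupant-place-occupied (o ∷ st)       (suc s) zero    c x _      at-u = at-u
occupant-place-occupied (o ∷ st)       (suc s) (suc u) c x free-s at-u =
  occupant-place-occupied st s u c x free-s at-u

catMaybes-place : ∀ st s c → free st s ≡ true → catMaybes (place st s c) ↭ c ∷ catMaybes st
catMaybes-place (nothing ∷ st) zero    c _      = ↭-refl
catMaybes-place (nothing ∷ st) (suc s) c free-s = catMaybes-place st s c free-s
catMaybes-place (just x ∷ st)  (suc s) c free-s =
  ↭-trans (↭-prep x (catMaybes-place st s c free-s)) (↭-swap x c ↭-refl)

length-place : ∀ st s c → length (place st s c) ≡ length st
length-place []       s       c = refl
length-place (o ∷ st) zero    c = refl
length-place (o ∷ st) (suc s) c = cong suc (length-place st s c)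

module _ (k ℓ : ℕ) where

  parkAll-∷ : ∀ st c cs a as s → chooseSpot k ℓ st a ≡ just s →
    parkAll k ℓ st (c ∷ cs) (a ∷ as) ≡ parkAll k ℓ (place st s c) cs as
  parkAll-∷ st c cs a as s chosen rewrite chosen = refl

  parkAll-occupant : ∀ st cs as fin u x → parkAll k ℓ st cs as ≡ just fin → occupant st u ≡ just x →
    occupant fin u ≡ just x
  parkAll-occupant st []       as       fin u x refl at-u = at-u
  parkAll-occupant st (c ∷ cs) []       fin u x refl at-u = at-u
  parkAll-occupant st (c ∷ cs) (a ∷ as) fin u x parked at-u with chooseSpot k ℓ st a in chosen
  ... | just s = parkAll-occupant (place st s c) cs as fin u x parked
                   (occupant-place-occupied st s u c x (chooseSpot-free k ℓ st a s chosen) at-u)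

  parkAll-catMaybes : ∀ st cs as fin → length cs ≡ length as → parkAll k ℓ st cs as ≡ just fin →
    catMaybes fin ↭ cs ++ catMaybes st × length fin ≡ length st
  parkAll-catMaybes st []       []       fin _      refl = ↭-refl , refl
  parkAll-catMaybes st (c ∷ cs) (a ∷ as) fin |cs|≡|as| parked with chooseSpot k ℓ st a in chosen
  ... | just s with parkAll-catMaybes (place st s c) cs as fin (suc-injective |cs|≡|as|) parked
  ...   | fin↭ , |fin|≡ =
    ↭-trans fin↭
      (↭-trans (++⁺ˡ cs (catMaybes-place st s c (chooseSpot-free k ℓ st a s chosen))) (shift c cs (catMaybes st))) ,
    trans |fin|≡ (length-place st s c)

catMaybes-replicate-nothing : ∀ n → catMaybes (replicate n (nothing {A = ℕ})) ≡ []
catMaybes-replicate-nothing zero    = refl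
catMaybes-replicate-nothing (suc n) = catMaybes-replicate-nothing n

map-fromMaybe-catMaybes : ∀ (os : List (Maybe ℕ)) → length (catMaybes os) ≡ length os →
  map (fromMaybe 0) os ≡ catMaybes os
map-fromMaybe-catMaybes []             _   = refl
map-fromMaybe-catMaybes (just x ∷ os)  len = cong (x ∷_) (map-fromMaybe-catMaybes os (suc-injective len))
map-fromMaybe-catMaybes (nothing ∷ os) len =
  contradiction (≤-trans (s≤s (length-catMaybes os)) (≤-reflexive (sym len))) (<-irrefl refl)

map-fromMaybe-injective : ∀ ρ os → All (0 <_) ρ → map (fromMaybe 0) os ≡ ρ → os ≡ map just ρ
map-fromMaybe-injective []      []             _         _  = refl
map-fromMaybe-injective (v ∷ ρ) (just x ∷ os)  (_ ∷ pos) eq =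
  cong₂ _∷_ (cong just (∷-injectiveˡ eq)) (map-fromMaybe-injective ρ os pos (∷-injectiveʳ eq))
map-fromMaybe-injective (v ∷ ρ) (nothing ∷ os) (0<v ∷ _) eq = contradiction (∷-injectiveˡ eq) (<⇒≢ 0<v)

map-fromMaybe-just : ∀ ρ → map (fromMaybe 0) (map just ρ) ≡ ρ
map-fromMaybe-just []      = refl
map-fromMaybe-just (x ∷ ρ) = cong (x ∷_) (map-fromMaybe-just ρ)

module _ (k ℓ t : ℕ) (T α : List ℕ) where

  containedOutcome-↭ : ∀ π → length α ≡ t → length T ≡ t → containedOutcome k ℓ t T α ≡ just π →
    ∃[ ρ ] π ≡ 0 ∷ ρ × ρ ↭ T
  containedOutcome-↭ π |α|≡t |T|≡t outcome with parkOn0t k ℓ t T α in parked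
  ... | just (nothing ∷ os) with refl ← outcome with parkAll-catMaybes k ℓ _ T α _ (trans |T|≡t (sym |α|≡t)) parked
  ...   | fin↭ , |fin|≡ = map (fromMaybe 0) os , refl , subst (_↭ T) (sym (map-fromMaybe-catMaybes os no-gaps)) os↭T
    where
    os↭T : catMaybes os ↭ T
    os↭T = subst (catMaybes os ↭_) (trans (cong (T ++_) (catMaybes-replicate-nothing t)) (++-identityʳ T)) fin↭
    no-gaps : length (catMaybes os) ≡ length os
    no-gaps = trans (↭-length os↭T) (trans |T|≡t (sym (suc-injective (trans |fin|≡ (length-replicate (suc t))))))

module _ (k ℓ : ℕ) (T ρ α : List ℕ) where

  private
    empty≡streetBefore-0 : replicate (suc (length ρ)) nothing ≡ streetBefore 0 ρ
    empty≡streetBefore-0 = cong (nothing ∷_) (nobody-before-0 ρ)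
      where
      nobody-before-0 : ∀ ρ → replicate (length ρ) nothing ≡ map (occupantBefore 0) ρ
      nobody-before-0 []      = refl
      nobody-before-0 (_ ∷ ρ) = cong (nothing ∷_) (nobody-before-0 ρ)

  -- An outcome records an empty spot as 0, so it determines the final street only for positive labels.
  containedOutcome⇒parkAll : All (0 <_) ρ → containedOutcome k ℓ (length ρ) T α ≡ just (0 ∷ ρ) →
    parkAll k ℓ (streetBefore 0 ρ) T α ≡ just (finalStreet ρ)
  containedOutcome⇒parkAll positive outcome with parkOn0t k ℓ (length ρ) T α in parked
  ... | just (nothing ∷ os) = trans (cong (λ st → parkAll k ℓ st T α) (sym empty≡streetBefore-0))
    (trans parked (cong (λ os → just (nothing ∷ os)) os≡ρ))
    where
    os≡ρ = map-fromMaybe-injective ρ os positive (∷-injectiveʳ (MP.just-injective outcome))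

  parkAll⇒containedOutcome : parkAll k ℓ (streetBefore 0 ρ) T α ≡ just (finalStreet ρ) →
    containedOutcome k ℓ (length ρ) T α ≡ just (0 ∷ ρ)
  parkAll⇒containedOutcome parked rewrite trans (cong (λ st → parkAll k ℓ st T α) empty≡streetBefore-0) parked =
    cong (λ ρ′ → just (0 ∷ ρ′)) (map-fromMaybe-just ρ)

words-length : ∀ t n {α} → α ∈ words t n → length α ≡ n
words-length t zero    (here refl) = refl
words-length t (suc n) α∈
  with a , _ , α∈′ ← find (∈-concatMap⁻ (λ a → map (a ∷_) (words t n)) {xs = map suc (upTo t)} α∈)
  with α′ , α′∈ , refl ← ∈-map⁻ (a ∷_) α∈′ = cong suc (words-length t n α′∈)

insertions-↭ : ∀ x ys {zs} → zs ∈ insertions x ys → zs ↭ x ∷ ys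
insertions-↭ x []       (here refl) = ↭-refl
insertions-↭ x (y ∷ ys) (here refl) = ↭-refl
insertions-↭ x (y ∷ ys) (there zs∈) with zs′ , zs′∈ , refl ← ∈-map⁻ (y ∷_) zs∈ =
  ↭-trans (↭-prep y (insertions-↭ x ys zs′∈)) (↭-swap y x ↭-refl)

perms-↭ : ∀ xs {ys} → ys ∈ perms xs → ys ↭ xs
perms-↭ []       (here refl) = ↭-refl
perms-↭ (x ∷ xs) ys∈ with zs , zs∈ , ys∈′ ← find (∈-concatMap⁻ (insertions x) {xs = perms xs} ys∈) =
  ↭-trans (insertions-↭ x zs ys∈′) (↭-prep x (perms-↭ xs zs∈))

_≟ₗ_ : DecidableEquality (List ℕ)
_≟ₗ_ = LP.≡-dec _≟_

occurrences : List ℕ → List (List ℕ) → ℕ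
occurrences zs L = length (filter (zs ≟ₗ_) L)

occurrences-map-∷-≡ : ∀ a r L → occurrences (a ∷ r) (map (a ∷_) L) ≡ occurrences r L
occurrences-map-∷-≡ a r L =
  trans (length-filter-map ((a ∷ r) ≟ₗ_) (a ∷_) L) (length-filter-≐ _ (r ≟ₗ_) (∷-injectiveʳ , cong (a ∷_)) L)

occurrences-map-∷-≢ : ∀ a r y L → a ≢ y → occurrences (a ∷ r) (map (y ∷_) L) ≡ 0
occurrences-map-∷-≢ a r y L a≢y = trans (length-filter-map ((a ∷ r) ≟ₗ_) (y ∷_) L)
  (cong length (filter-none _ (universal (λ _ eq → a≢y (∷-injectiveˡ eq)) L)))

occurrences-insertions : ∀ x as bs ys → x ∉ as → x ∉ ys →
  occurrences (as ++ x ∷ bs) (insertions x ys) ≡ occurrences (as ++ bs) [ ys ]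
occurrences-insertions x []       bs []       _    _    = occurrences-map-∷-≡ x bs [ [] ]
occurrences-insertions x []       bs (y ∷ ys) _    x∉ys = begin
  occurrences (x ∷ bs) ((x ∷ y ∷ ys) ∷ map (y ∷_) (insertions x ys))
    ≡⟨ length-filter-∷ ((x ∷ bs) ≟ₗ_) (x ∷ y ∷ ys) _ ⟩
  occurrences (x ∷ bs) [ x ∷ y ∷ ys ] + occurrences (x ∷ bs) (map (y ∷_) (insertions x ys))
    ≡⟨ cong₂ _+_ (occurrences-map-∷-≡ x bs [ y ∷ ys ]) (occurrences-map-∷-≢ x bs y (insertions x ys) (x∉ys ∘′ here)) ⟩
  occurrences bs [ y ∷ ys ] + 0
    ≡⟨ +-identityʳ _ ⟩
  occurrences bs [ y ∷ ys ] ∎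
  where open ≡-Reasoning
occurrences-insertions x (a ∷ as) bs []       x∉as _    =
  occurrences-map-∷-≢ a (as ++ x ∷ bs) x [ [] ] (x∉as ∘′ here ∘′ sym)
occurrences-insertions x (a ∷ as) bs (y ∷ ys) x∉as x∉ys = begin
  occurrences (a ∷ as ++ x ∷ bs) ((x ∷ y ∷ ys) ∷ map (y ∷_) (insertions x ys))
    ≡⟨ length-filter-∷ ((a ∷ as ++ x ∷ bs) ≟ₗ_) (x ∷ y ∷ ys) _ ⟩
  occurrences (a ∷ as ++ x ∷ bs) [ x ∷ y ∷ ys ] + occurrences (a ∷ as ++ x ∷ bs) (map (y ∷_) (insertions x ys))
    ≡⟨ cong (_+ occurrences (a ∷ as ++ x ∷ bs) (map (y ∷_) (insertions x ys)))
            (occurrences-map-∷-≢ a _ x [ y ∷ ys ] (x∉as ∘′ here ∘′ sym)) ⟩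
  occurrences (a ∷ as ++ x ∷ bs) (map (y ∷_) (insertions x ys))
    ≡⟨ after-head (a ≟ y) ⟩
  occurrences (a ∷ as ++ bs) [ y ∷ ys ] ∎
  where
  open ≡-Reasoning
  after-head : Dec (a ≡ y) →
    occurrences (a ∷ as ++ x ∷ bs) (map (y ∷_) (insertions x ys)) ≡ occurrences (a ∷ as ++ bs) [ y ∷ ys ]
  after-head (yes refl) = begin
    occurrences (a ∷ as ++ x ∷ bs) (map (a ∷_) (insertions x ys))
      ≡⟨ occurrences-map-∷-≡ a _ (insertions x ys) ⟩
    occurrences (as ++ x ∷ bs) (insertions x ys)
      ≡⟨ occurrences-insertions x as bs ys (x∉as ∘′ there) (x∉ys ∘′ there) ⟩
    occurrences (as ++ bs) [ ys ]
      ≡⟨ occurrences-map-∷-≡ a _ [ ys ] ⟨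
    occurrences (a ∷ as ++ bs) [ a ∷ ys ] ∎
  after-head (no a≢y) = trans (occurrences-map-∷-≢ a _ y (insertions x ys) a≢y)
    (sym (occurrences-map-∷-≢ a _ y [ ys ] a≢y))

occurrences-perms : ∀ T → Unique T → ∀ ρ → ρ ↭ T → occurrences ρ (perms T) ≡ 1
occurrences-perms []       _               ρ ρ↭[] with refl ← ↭-empty-inv ρ↭[] = refl
occurrences-perms (x ∷ xs) (x≢xs ∷ unique) ρ ρ↭x∷xs
  with as , bs , refl ← ∈-∃++ (∈-resp-↭ (↭-sym ρ↭x∷xs) (here refl)) = begin
  occurrences (as ++ x ∷ bs) (concatMap (insertions x) (perms xs))
    ≡⟨ length-filter-concatMap _ (insertions x) (perms xs) ⟩
  sum (map (λ ys → occurrences (as ++ x ∷ bs) (insertions x ys)) (perms xs))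
    ≡⟨ cong sum (map-cong-local (All.tabulate λ {ys} ys∈ → occurrences-insertions x as bs ys x∉as (x∉ ys∈))) ⟩
  sum (map (λ ys → occurrences (as ++ bs) [ ys ]) (perms xs))
    ≡⟨ length-filter-concatMap _ [_] (perms xs) ⟨
  occurrences (as ++ bs) (concatMap [_] (perms xs))
    ≡⟨ cong (occurrences (as ++ bs)) (concatMap-pure (perms xs)) ⟩
  occurrences (as ++ bs) (perms xs)
    ≡⟨ occurrences-perms xs unique (as ++ bs) as++bs↭xs ⟩
  1 ∎
  where
  open ≡-Reasoning
  as++bs↭xs : as ++ bs ↭ xs
  as++bs↭xs = drop-∷ (↭-trans (↭-sym (shift x as bs)) ρ↭x∷xs)
  x∉xs : x ∉ xs
  x∉xs = All¬⇒¬Any x≢xs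
  x∉as : x ∉ as
  x∉as x∈as = x∉xs (∈-resp-↭ as++bs↭xs (∈-++⁺ˡ x∈as))
  x∉ : ∀ {ys} → ys ∈ perms xs → x ∉ ys
  x∉ ys∈ x∈ys = x∉xs (∈-resp-↭ (perms-↭ xs ys∈) x∈ys)

-- Counting the preference lists with a given outcome

indexOf : ℕ → List ℕ → ℕ
indexOf c []       = 0
indexOf c (x ∷ xs) with c ≟ x
... | yes _ = 0
... | no  _ = suc (indexOf c xs)

indexOf-head : ∀ x xs → indexOf x (x ∷ xs) ≡ 0
indexOf-head x xs with x ≟ x
... | yes _   = refl
... | no  x≢x = contradiction refl x≢x

indexOf-tail : ∀ c x xs → c ≢ x → indexOf c (x ∷ xs) ≡ suc (indexOf c xs)
indexOf-tail c x xs c≢x with c ≟ x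
... | yes c≡x = contradiction c≡x c≢x
... | no  _   = refl

indexOf-at : ∀ {c} xs → c ∈ xs → indexOf c xs < length xs × at xs (indexOf c xs) ≡ c
indexOf-at {c} (x ∷ xs) c∈ with c ≟ x | c∈
... | yes c≡x | _          = z<s , sym c≡x
... | no  c≢x | here c≡x   = contradiction c≡x c≢x
... | no  _   | there c∈xs with i<n , at-i ← indexOf-at xs c∈xs = s≤s i<n , at-i

occupant-map-just-∈ : ∀ xs u {c} → occupant (map just xs) u ≡ just c → c ∈ xs
occupant-map-just-∈ (x ∷ xs) zero    refl = here refl
occupant-map-just-∈ (x ∷ xs) (suc u) at-u = there (occupant-map-just-∈ xs u at-u)

indexOf-occupant : ∀ ρ → Unique ρ → ∀ u c → occupant (map just ρ) u ≡ just c → indexOf c ρ ≡ u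
indexOf-occupant (x ∷ xs) _              zero    c refl = indexOf-head x xs
indexOf-occupant (x ∷ xs) (x≢xs ∷ uniq) (suc u) c at-u =
  trans (indexOf-tail c x xs c≢x) (cong suc (indexOf-occupant xs uniq u c at-u))
  where
  c≢x : c ≢ x
  c≢x refl = All¬⇒¬Any x≢xs (occupant-map-just-∈ xs u at-u)

map-indexOf : ∀ {X : Set} ρ → Unique ρ → (g : ℕ → X) → map (λ c → g (indexOf c ρ)) ρ ≡ applyUpTo g (length ρ)
map-indexOf []       _              g = refl
map-indexOf (x ∷ xs) (x≢xs ∷ uniq) g = cong₂ _∷_ (cong g (indexOf-head x xs))
  (trans (map-cong-local (All.map (λ {v} x≢v → cong g (indexOf-tail v x xs (x≢v ∘′ sym))) x≢xs))
         (map-indexOf xs uniq (λ i → g (suc i))))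

occupantBefore-below : ∀ {c v} → v < c → occupantBefore c v ≡ just v
occupantBefore-below v<c rewrite <ᵇ≡true v<c = refl

occupantBefore-above : ∀ {c v} → c ≤ v → occupantBefore c v ≡ nothing
occupantBefore-above c≤v rewrite <ᵇ≡false (≤⇒≯ c≤v) = refl

occupantBefore-suc : ∀ {c v} → v ≢ c → occupantBefore c v ≡ occupantBefore (suc c) v
occupantBefore-suc {c} {v} v≢c with <-cmp v c
... | tri< v<c _ _ = trans (occupantBefore-below v<c) (sym (occupantBefore-below (m<n⇒m<1+n v<c)))
... | tri≈ _ v≡c _ = contradiction v≡c v≢c
... | tri> _ _ c<v = trans (occupantBefore-above (<⇒≤ c<v)) (sym (occupantBefore-above c<v))

streetBefore-skip : ∀ {m c} ρ → m ≤ c → All (λ v → v < m ⊎ c ≤ v) ρ → streetBefore m ρ ≡ streetBefore c ρ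
streetBefore-skip {m} {c} ρ m≤c outside = cong (nothing ∷_) (map-cong-local (All.map same outside))
  where
  same : ∀ {v} → v < m ⊎ c ≤ v → occupantBefore m v ≡ occupantBefore c v
  same (inj₁ v<m) = trans (occupantBefore-below v<m) (sym (occupantBefore-below (<-≤-trans v<m m≤c)))
  same (inj₂ c≤v) = trans (occupantBefore-above (≤-trans m≤c c≤v)) (sym (occupantBefore-above c≤v))

place-streetBefore : ∀ c ρ → Unique ρ → c ∈ ρ →
  place (streetBefore c ρ) (suc (indexOf c ρ)) c ≡ streetBefore (suc c) ρ
place-streetBefore c ρ uniq c∈ = cong (nothing ∷_) (place-occupants ρ uniq c∈)
  where
  place-occupants : ∀ ρ → Unique ρ → c ∈ ρ →
    place (map (occupantBefore c) ρ) (indexOf c ρ) c ≡ map (occupantBefore (suc c)) ρ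
  place-occupants (x ∷ xs) (x≢xs ∷ uniq) c∈ with c ≟ x | c∈
  ... | yes refl | _          = cong₂ _∷_ (sym (occupantBefore-below (n<1+n c)))
                                  (map-cong-local (All.map (λ c≢v → occupantBefore-suc (c≢v ∘′ sym)) x≢xs))
  ... | no c≢x   | here c≡x   = contradiction c≡x c≢x
  ... | no c≢x   | there c∈xs = cong₂ _∷_ (occupantBefore-suc (c≢x ∘′ sym)) (place-occupants xs uniq c∈xs)

_≟ˢ_ : DecidableEquality (Maybe Street)
_≟ˢ_ = MP.≡-dec (LP.≡-dec (MP.≡-dec _≟_))

preferencesOf : (k ℓ : ℕ) → List ℕ → ℕ → ℕ
preferencesOf k ℓ ρ c = preferencesInto k ℓ (length ρ) (streetBefore c ρ) (suc (indexOf c ρ))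

preferencesOf-at : ∀ k ℓ ρ → All (0 <_) ρ → ∀ {c} → c ∈ ρ →
  preferencesOf k ℓ ρ c ≡ B k (0 ∷ ρ) (suc (indexOf c ρ)) + F k ℓ (0 ∷ ρ) (suc (indexOf c ρ)) + 1
preferencesOf-at k ℓ ρ positive {c} c∈ρ with j<t , at-j≡c ← indexOf-at ρ c∈ρ =
  trans (cong (λ c′ → preferencesInto k ℓ (length ρ) (streetBefore c′ ρ) (suc j)) (sym at-j≡c))
        (Window.preferencesInto≡B+F+1 (runs-streetBefore ρ positive j j<t) k ℓ)
  where j = indexOf c ρ

product-preferencesOf : ∀ k ℓ ρ → Unique ρ → All (0 <_) ρ →
  product (map (preferencesOf k ℓ ρ) ρ) ≡ weight k ℓ (length ρ) (0 ∷ ρ)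
product-preferencesOf k ℓ ρ uniq positive = begin
  product (map (preferencesOf k ℓ ρ) ρ)
    ≡⟨ cong product (map-cong-local (All.tabulate (preferencesOf-at k ℓ ρ positive))) ⟩
  product (map (λ c → spotWeight (suc (indexOf c ρ))) ρ)
    ≡⟨ cong product (map-indexOf ρ uniq (spotWeight ∘′ suc)) ⟩
  product (applyUpTo (spotWeight ∘′ suc) (length ρ))
    ≡⟨ cong product (trans (sym (map-∘ (upTo (length ρ)))) (map-applyUpTo id (spotWeight ∘′ suc) (length ρ))) ⟨
  weight k ℓ (length ρ) (0 ∷ ρ) ∎
  where
  open ≡-Reasoning
  spotWeight : ℕ → ℕ
  spotWeight i = B k (0 ∷ ρ) i + F k ℓ (0 ∷ ρ) i + 1

module _ (k ℓ : ℕ) (ρ : List ℕ) (uniq : Unique ρ) where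

  parkAll-misplaced : ∀ st c cs a as → chooseSpot k ℓ st a ≢ just (suc (indexOf c ρ)) →
    parkAll k ℓ st (c ∷ cs) (a ∷ as) ≢ just (finalStreet ρ)
  parkAll-misplaced st c cs a as misplaced parked with chooseSpot k ℓ st a in chosen
  ... | just s with parkAll-occupant k ℓ (place st s c) cs as (finalStreet ρ) s c parked
                      (occupant-place st s c (chooseSpot-free k ℓ st a s chosen))
  ...   | at-s with s
  ...     | suc u = misplaced (cong (just ∘′ suc) (sym (indexOf-occupant ρ uniq u c at-s)))

  length-filter-parkAll-∷ : ∀ c cs a W → c ∈ ρ →
    (d : Dec (chooseSpot k ℓ (streetBefore c ρ) a ≡ just (suc (indexOf c ρ)))) →
    length (filter (λ as → parkAll k ℓ (streetBefore c ρ) (c ∷ cs) (a ∷ as) ≟ˢ just (finalStreet ρ)) W)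
      ≡ (if does d then length (filter (λ as → parkAll k ℓ (streetBefore (suc c) ρ) cs as ≟ˢ just (finalStreet ρ)) W) else 0)
  length-filter-parkAll-∷ c cs a W c∈ρ (yes chosen) = length-filter-≐ _ _
    (trans (sym (continue _)) , trans (continue _)) W
    where
    continue : ∀ as → parkAll k ℓ (streetBefore c ρ) (c ∷ cs) (a ∷ as) ≡ parkAll k ℓ (streetBefore (suc c) ρ) cs as
    continue as = trans (parkAll-∷ k ℓ (streetBefore c ρ) c cs a as _ chosen)
      (cong (λ st → parkAll k ℓ st cs as) (place-streetBefore c ρ uniq c∈ρ))
  length-filter-parkAll-∷ c cs a W c∈ρ (no misplaced) =
    cong length (filter-none _ (universal (λ as → parkAll-misplaced (streetBefore c ρ) c cs a as misplaced) W))

  -- m bounds the cars still to park from below: those of ρ below m have parked, the others are cs.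
  length-filter-parkAll : ∀ cs m → AllPairs _<_ cs → All (m ≤_) cs → All (λ v → v < m ⊎ v ∈ cs) ρ → All (_∈ ρ) cs →
    length (filter (λ α → parkAll k ℓ (streetBefore m ρ) cs α ≟ˢ just (finalStreet ρ)) (words (length ρ) (length cs)))
      ≡ product (map (preferencesOf k ℓ ρ) cs)
  length-filter-parkAll [] m _ _ parked _ =
    cong length (filter-accept (λ α → parkAll k ℓ (streetBefore m ρ) [] α ≟ˢ just (finalStreet ρ)) {xs = []}
      (cong (just ∘′ (nothing ∷_)) (map-cong-local (All.map (λ { (inj₁ v<m) → occupantBefore-below v<m }) parked))))
  length-filter-parkAll (c ∷ cs) m (c<cs ∷ sorted) (m≤c ∷ m≤cs) parked-or-next (c∈ρ ∷ cs⊆ρ) = begin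
    length (filter (λ α → parkAll k ℓ (streetBefore m ρ) (c ∷ cs) α ≟ˢ just (finalStreet ρ)) (words t (suc (length cs))))
      ≡⟨ cong (λ st → length (filter (λ α → parkAll k ℓ st (c ∷ cs) α ≟ˢ just (finalStreet ρ)) (words t (suc (length cs)))))
              (streetBefore-skip ρ m≤c (All.map skip parked-or-next)) ⟩
    length (filter parked? (concatMap (λ a → map (a ∷_) W) preferences))
      ≡⟨ length-filter-concatMap parked? (λ a → map (a ∷_) W) preferences ⟩
    sum (map (λ a → length (filter parked? (map (a ∷_) W))) preferences)
      ≡⟨ cong sum (map-cong (λ a → trans (length-filter-map parked? (a ∷_) W) (length-filter-parkAll-∷ c cs a W c∈ρ (chosen? a)))
                            preferences) ⟩
    sum (map (λ a → if does (chosen? a) then rest else 0) preferences)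
      ≡⟨ sum-map-if chosen? rest preferences ⟩
    preferencesOf k ℓ ρ c * rest
      ≡⟨ cong (preferencesOf k ℓ ρ c *_) (length-filter-parkAll cs (suc c) sorted c<cs (All.map next parked-or-next) cs⊆ρ) ⟩
    preferencesOf k ℓ ρ c * product (map (preferencesOf k ℓ ρ) cs) ∎
    where
    open ≡-Reasoning
    t : ℕ
    t = length ρ
    W : List (List ℕ)
    W = words t (length cs)
    rest : ℕ
    rest = length (filter (λ α → parkAll k ℓ (streetBefore (suc c) ρ) cs α ≟ˢ just (finalStreet ρ)) W)
    preferences : List ℕ
    preferences = map suc (upTo t)
    parked? : ∀ α → Dec (parkAll k ℓ (streetBefore c ρ) (c ∷ cs) α ≡ just (finalStreet ρ))
    parked? α = parkAll k ℓ (streetBefore c ρ) (c ∷ cs) α ≟ˢ just (finalStreet ρ)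
    chosen? : ∀ a → Dec (chooseSpot k ℓ (streetBefore c ρ) a ≡ just (suc (indexOf c ρ)))
    chosen? a = MP.≡-dec _≟_ (chooseSpot k ℓ (streetBefore c ρ) a) (just (suc (indexOf c ρ)))

    skip : ∀ {v} → v < m ⊎ v ∈ c ∷ cs → v < m ⊎ c ≤ v
    skip (inj₁ v<m)          = inj₁ v<m
    skip (inj₂ (here refl))  = inj₂ ≤-refl
    skip (inj₂ (there v∈cs)) = inj₂ (<⇒≤ (All.lookup c<cs v∈cs))

    next : ∀ {v} → v < m ⊎ v ∈ c ∷ cs → v < suc c ⊎ v ∈ cs
    next (inj₁ v<m)          = inj₁ (m<n⇒m<1+n (<-≤-trans v<m m≤c))
    next (inj₂ (here refl))  = inj₁ (n<1+n c)
    next (inj₂ (there v∈cs)) = inj₂ v∈cs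

length-filter-containedOutcome : ∀ k ℓ t T → length T ≡ t → AllPairs _<_ T → All (0 <_) T → ∀ ρ → ρ ↭ T →
  length (filter (λ α → MP.≡-dec _≟ₗ_ (containedOutcome k ℓ t T α) (just (0 ∷ ρ))) (words t t)) ≡ weight k ℓ t (0 ∷ ρ)
length-filter-containedOutcome k ℓ t T |T|≡t sorted positive ρ ρ↭T with refl ← trans (↭-length ρ↭T) |T|≡t = begin
  length (filter (λ α → MP.≡-dec _≟ₗ_ (containedOutcome k ℓ t T α) (just (0 ∷ ρ))) (words t t))
    ≡⟨ length-filter-≐ _ _ (containedOutcome⇒parkAll k ℓ T ρ _ positiveρ , parkAll⇒containedOutcome k ℓ T ρ _) (words t t) ⟩
  length (filter parked? (words t t))
    ≡⟨ cong (λ n → length (filter parked? (words t n))) (sym |T|≡t) ⟩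
  length (filter parked? (words t (length T)))
    ≡⟨ length-filter-parkAll k ℓ ρ uniq T 0 sorted (All.universal (λ _ → z≤n) T)
         (All.tabulate (inj₂ ∘′ ∈-resp-↭ ρ↭T)) (All.tabulate (∈-resp-↭ (↭-sym ρ↭T))) ⟩
  product (map (preferencesOf k ℓ ρ) T)
    ≡⟨ product-↭ (map⁺ (preferencesOf k ℓ ρ) (↭-sym ρ↭T)) ⟩
  product (map (preferencesOf k ℓ ρ) ρ)
    ≡⟨ product-preferencesOf k ℓ ρ uniq positiveρ ⟩
  weight k ℓ t (0 ∷ ρ) ∎
  where
  open ≡-Reasoning
  parked? : ∀ α → Dec (parkAll k ℓ (streetBefore 0 ρ) T α ≡ just (finalStreet ρ))
  parked? α = parkAll k ℓ (streetBefore 0 ρ) T α ≟ˢ just (finalStreet ρ)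
  uniq : Unique ρ
  uniq = Unique-resp-↭ (↭⇒↭ₛ (↭-sym ρ↭T)) (AllPairs.map <⇒≢ sorted)
  positiveρ : All (0 <_) ρ
  positiveρ = All-resp-↭ (↭-sym ρ↭T) positive

isContained≡is-just : ∀ k ℓ t T α → isContained k ℓ t T α ≡ is-just (containedOutcome k ℓ t T α)
isContained≡is-just k ℓ t T α with containedOutcome k ℓ t T α
... | just _  = refl
... | nothing = refl

containedOutcome-once : ∀ k ℓ t T → length T ≡ t → Unique T →
  All (λ α → ∀ π → containedOutcome k ℓ t T α ≡ just π → occurrences π (wordsT T) ≡ 1) (words t t)
containedOutcome-once k ℓ t T |T|≡t uniq = All.tabulate λ {α} α∈ π contained →
  let ρ , π≡0∷ρ , ρ↭T = containedOutcome-↭ k ℓ t T α π (words-length t t α∈) |T|≡t contained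
  in subst (λ π → occurrences π (wordsT T) ≡ 1) (sym π≡0∷ρ)
       (trans (occurrences-map-∷-≡ 0 ρ (perms T)) (occurrences-perms T uniq ρ ρ↭T))

length-filter-isContained : ∀ k ℓ t T → length T ≡ t → Unique T →
  length (filter (λ α → T? (isContained k ℓ t T α)) (words t t))
    ≡ sum (map (λ π → length (filter (λ α → MP.≡-dec _≟ₗ_ (containedOutcome k ℓ t T α) (just π)) (words t t))) (wordsT T))
length-filter-isContained k ℓ t T |T|≡t uniq =
  trans (length-filter-≐ _ _ ((λ {α} → subst Bool.T (isContained≡is-just k ℓ t T α)) ,
                              (λ {α} → subst Bool.T (sym (isContained≡is-just k ℓ t T α)))) (words t t))
        (length-filter-is-just _≟ₗ_ (containedOutcome k ℓ t T) (wordsT T) (words t t)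
          (containedOutcome-once k ℓ t T |T|≡t uniq))

theorem3p11 : (k ℓ t : ℕ) (Tset : List ℕ) → 1 ≤ t → length Tset ≡ t → Linked _<_ Tset → All (0 <_) Tset →
    (length (filter (λ α → T? (isContained k ℓ t Tset α)) (words t t))
       ≡ sum (map (weight k ℓ t) (wordsT Tset)))
    × ((π : List ℕ) → π ∈ wordsT Tset →
       length (filter (λ α → MP.≡-dec (LP.≡-dec _≟_) (containedOutcome k ℓ t Tset α) (just π)) (words t t))
         ≡ weight k ℓ t π)
theorem3p11 k ℓ t Tset _ |T|≡t linked positive = count-contained , count-outcome
  where
  sorted : AllPairs _<_ Tset
  sorted = Linked⇒AllPairs <-trans linked

  count-outcome : ∀ π → π ∈ wordsT Tset →
    length (filter (λ α → MP.≡-dec _≟ₗ_ (containedOutcome k ℓ t Tset α) (just π)) (words t t)) ≡ weight k ℓ t π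
  count-outcome π π∈ with ρ , ρ∈ , refl ← ∈-map⁻ (0 ∷_) π∈ =
    length-filter-containedOutcome k ℓ t Tset |T|≡t sorted positive ρ (perms-↭ Tset ρ∈)

  count-contained : length (filter (λ α → T? (isContained k ℓ t Tset α)) (words t t)) ≡ sum (map (weight k ℓ t) (wordsT Tset))
  count-contained = trans (length-filter-isContained k ℓ t Tset |T|≡t (AllPairs.map <⇒≢ sorted))
                          (cong sum (map-cong-local (All.tabulate (count-outcome _))))
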